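{- Let $\mathcal{H}=(\mathcal{V},\mathcal{E})$ be a $3$-uniform Berge-$K_4$-saturated hypergraph and let $u,v\in\mathcal{V}$ be distinct. If $\mathcal{T}$ can be added on $(u,v)$, then for every positive integer $k$, $k$ copies of $\mathcal{T}$ can be added on $(u,v)$ simultaneously; that is, the hypergraph obtained from $\mathcal{H}$ by adding $2k$ new vertices $a_1^i,a_2^i$ ($1\le i\le k$) and the $2k$ hyperedges $a_1^ia_2^iu,\ a_1^ia_2^iv$ ($1\le i\le k$) is Berge-$K_4$-saturated. Moreover, it is impossible to add two copies of $\mathcal{T}$ simultaneously on two distinct pairs of vertices of $\mathcal{V}$: if $\{u,v\}\neq\{u',v'\}$ are two pairs of distinct vertices of $\mathcal{V}$, then the hypergraph obtained from $\mathcal{H}$ by adding new vertices $a_1,a_2,a_3,a_4$ and hyperedges $a_1a_2u,\ a_1a_2v,\ a_3a_4u',\ a_3a_4v'$ is not Berge-$K_4$-saturated.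
   Context: A $3$-graph is a hypergraph all of whose hyperedges have exactly $3$ vertices. Given a graph $F$, a hypergraph $\mathcal{H}$ is a Berge-$F$ if there is a bijection $\phi:E(F)\to E(\mathcal{H})$ with $\{u,v\}\subseteq\phi(uv)$ for every edge $uv\in E(F)$. A hypergraph contains a Berge-$F$ if some subset of its hyperedges forms a Berge-$F$; it is Berge-$F$-free otherwise. A $3$-graph $\mathcal{H}$ on vertex set $V$ is Berge-$K_4$-saturated if it is Berge-$K_4$-free but for every $3$-subset $S\subseteq V$ with $S\notin E(\mathcal{H})$, adding $S$ as a hyperedge creates a Berge-$K_4$. Let $\mathcal{T}$ be the $3$-graph on $\{a_1,a_2,x_1,x_2\}$ with hyperedges $a_1a_2x_1$ and $a_1a_2x_2$. We say $\mathcal{T}$ can be added on $(u,v)$ if the hypergraph obtained from $\mathcal{H}$ by identifying $x_1$ with $u$ and $x_2$ with $v$ and attaching $\mathcal{T}$ (with $a_1,a_2$ two new vertices), i.e. adding new vertices $a_1,a_2$ and hyperedges $a_1a_2u,a_1a_2v$, is Berge-$K_4$-saturated. -}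

module Defs where

open import Data.Nat using (ℕ; _+_; _*_)
open import Data.Fin using (Fin; zero; suc; _↑ˡ_; _↑ʳ_; combine)
open import Data.Fin.Subset using (Subset; _∈_; _∉_; ⁅_⁆; _∪_; ∣_∣; outside)
open import Data.Vec using (_++_; replicate)
open import Data.Product using (Σ; _×_; _,_; ∃)
open import Data.Sum using (_⊎_)
open import Relation.Binary.PropositionalEquality using (_≡_; _≢_)
open import Relation.Nullary using (¬_)

Hypergraph : ℕ → Set₁
Hypergraph n = Subset n → Set

Uniform3 : ∀ {n} → Hypergraph n → Set
Uniform3 {n} E = ∀ (S : Subset n) → E S → ∣ S ∣ ≡ 3

-- A Berge-K4 in E: four distinct core vertices x0..x3 and six pairwise
-- distinct hyperedges e_ij with {x_i , x_j} ⊆ e_ij (this is exactly a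
-- bijection between E(K4) and a set of six hyperedges of E).
record BergeK4 {n : ℕ} (E : Hypergraph n) : Set where
  field
    x0 x1 x2 x3 : Fin n
    d01 : x0 ≢ x1
    d02 : x0 ≢ x2
    d03 : x0 ≢ x3
    d12 : x1 ≢ x2
    d13 : x1 ≢ x3
    d23 : x2 ≢ x3
    e01 e02 e03 e12 e13 e23 : Subset n
    h01 : E e01
    h02 : E e02
    h03 : E e03
    h12 : E e12
    h13 : E e13
    h23 : E e23
    m01 : x0 ∈ e01 × x1 ∈ e01
    m02 : x0 ∈ e02 × x2 ∈ e02
    m03 : x0 ∈ e03 × x3 ∈ e03
    m12 : x1 ∈ e12 × x2 ∈ e12
    m13 : x1 ∈ e13 × x3 ∈ e13
    m23 : x2 ∈ e23 × x3 ∈ e23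
    n01-02 : e01 ≢ e02
    n01-03 : e01 ≢ e03
    n01-12 : e01 ≢ e12
    n01-13 : e01 ≢ e13
    n01-23 : e01 ≢ e23
    n02-03 : e02 ≢ e03
    n02-12 : e02 ≢ e12
    n02-13 : e02 ≢ e13
    n02-23 : e02 ≢ e23
    n03-12 : e03 ≢ e12
    n03-13 : e03 ≢ e13
    n03-23 : e03 ≢ e23
    n12-13 : e12 ≢ e13
    n12-23 : e12 ≢ e23
    n13-23 : e13 ≢ e23

BergeK4Free : ∀ {n} → Hypergraph n → Set
BergeK4Free E = ¬ BergeK4 E

addEdge : ∀ {n} → Hypergraph n → Subset n → Hypergraph n
addEdge E S T = E T ⊎ T ≡ S

Saturated : ∀ {n} → Hypergraph n → Set
Saturated {n} E =
  BergeK4Free E ×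
  (∀ (S : Subset n) → ∣ S ∣ ≡ 3 → ¬ E S → BergeK4 (addEdge E S))

-- Old vertices u : Fin n become u ↑ˡ (k*2);
-- copy i : Fin k gets the two new vertices a1 i, a2 i, and is attached
-- to the pair p i = (x , y) via the hyperedges a1 a2 x and a1 a2 y.
oldV : ∀ {n} k → Fin n → Fin (n + k * 2)
oldV k u = u ↑ˡ (k * 2)

a1 : ∀ {n k} → Fin k → Fin (n + k * 2)
a1 {n} i = n ↑ʳ combine i zero

a2 : ∀ {n k} → Fin k → Fin (n + k * 2)
a2 {n} i = n ↑ʳ combine i (suc zero)

liftSet : ∀ {n} k → Subset n → Subset (n + k * 2)
liftSet k T = T ++ replicate (k * 2) outside

triple : ∀ {m} → Fin m → Fin m → Fin m → Subset m
triple a b c = ⁅ a ⁆ ∪ ⁅ b ⁆ ∪ ⁅ c ⁆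

addCopies : ∀ {n} → Hypergraph n → (k : ℕ) → (Fin k → Fin n × Fin n)
          → Hypergraph (n + k * 2)
addCopies {n} E k p S =
  (Σ (Subset n) λ T → E T × S ≡ liftSet k T)
  ⊎ (Σ (Fin k) λ i → Σ (Fin n) λ x → Σ (Fin n) λ y →
       p i ≡ (x , y) × (S ≡ triple (a1 i) (a2 i) (oldV k x)
                        ⊎ S ≡ triple (a1 i) (a2 i) (oldV k y)))

CanAddT : ∀ {n} → Hypergraph n → Fin n → Fin n → Set
CanAddT E u v = Saturated (addCopies E 1 (λ _ → (u , v)))

twoPairs : ∀ {n} → Fin n → Fin n → Fin n → Fin n → Fin 2 → Fin n × Fin n
twoPairs u v u′ v′ zero = (u , v)
twoPairs u v u′ v′ (suc _) = (u′ , v′)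

{-# OPTIONS --safe #-}
-- Core vertices of a Berge-K₄ lie in at least three of its hyperedges, while the two new
-- vertices of a copy of 𝒯 on (x, y) lie only in a₁a₂x and a₁a₂y. So new vertices are never
-- core vertices, a Berge-K₄ of the extension restricts to one of H, and attaching copies of 𝒯
-- keeps H Berge-K₄-free.
--
-- For k copies on (u, v), a 3-set S that is not a hyperedge either lies in the old vertices
-- plus one copy, and then the Berge-K₄ obtained by adding S to the one-copy hypergraph is
-- carried over along the embedding of that copy, or it meets two copies c ≠ c′, and then
-- a new vertex of each copy together with u and v span a Berge-K₄ through S, the four
-- hyperedges of the two copies and a hyperedge of H through u and v. That hyperedge exists:
-- adding a₁a₂w (w ∉ {u, v}) to the one-copy hypergraph creates a Berge-K₄ that cannot
-- restrict to H, so a new vertex and with it u and v are core vertices, and the hyperedge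
-- joining u and v belongs to H. If there is no such w, H has no hyperedges at all and a₁uv
-- can be added without creating a Berge-K₄.
--
-- For copies on distinct pairs, adding a₁a₂a₃ creates no Berge-K₄: a₄ lies in two hyperedges
-- only; a core a₃ would force a core vertex of the first copy and hence u and v into the core,
-- while all core vertices other than a₃ lie in a₃a₄u′ ∪ a₃a₄v′ ∪ a₁a₂a₃, so {u, v} = {u′, v′};
-- and two new vertices lying in the same three hyperedges cannot both be core vertices.

module Submission where

open import Defs
open import Data.Nat using (ℕ; _≤_; _+_; _*_; suc)
open import Data.Nat.Properties using (n≮n; ≤-trans; ≤-reflexive)
open import Data.Fin using (Fin; zero; suc; _≟_; _↑ˡ_; _↑ʳ_; combine; splitAt; join)
open import Data.Fin.Patterns using (0F; 1F; 2F; 3F; 4F; 5F)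
open import Data.Fin.Properties as Fin
  using (all?; any?; ↑ˡ-injective; ↑ʳ-injective; combine-injective; combine-surjective;
         splitAt-↑ˡ; splitAt-↑ʳ; splitAt⁻¹-↑ˡ; splitAt⁻¹-↑ʳ; join-splitAt)
open import Data.Fin.Subset using (Subset; _∈_; _∉_; _⊆_; ⁅_⁆; _∪_; ∣_∣; inside; outside) renaming (⊥ to ∅)
open import Data.Fin.Subset.Properties
  using (x∈p∪q⁻; x∈p∪q⁺; x∈⁅x⁆; x∈⁅y⁆⇒x≡y; ∉⊥; ⊆-antisym; ∪-identityˡ; ∣⁅x⁆∣≡1; ∣⊥∣≡0; _∈?_; p⊆q⇒∣p∣≤∣q∣)
open import Data.Vec using (Vec; []; _∷_; lookup; tabulate; replicate; here; there)
open import Data.Vec.Properties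
  using (lookup∘tabulate; []=⇒lookup; lookup⇒[]=; lookup-++ˡ; lookup-++ʳ; lookup-replicate)
open import Data.Vec.Relation.Unary.Unique.Propositional.Properties using (lookup-injective)
open import Data.Vec.Relation.Unary.AllPairs using ([]; _∷_)
open import Data.Vec.Relation.Unary.All using ([]; _∷_)
open import Data.Vec.Relation.Unary.Unique.Propositional using (Unique)
open import Data.Product as Product using (∃; ∃₂; _×_; _,_; proj₁; proj₂)
open import Data.Product.Properties using (≡-dec)
open import Data.Sum as Sum using (_⊎_; inj₁; inj₂; [_,_]′)
open import Data.Empty using (⊥; ⊥-elim)
open import Function using (_∘_; id)
open import Function.Definitions using (Injective)
open import Relation.Binary.PropositionalEquality
  using (_≡_; _≢_; refl; sym; trans; cong; subst; ≢-sym; module ≡-Reasoning)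
open import Relation.Binary.Definitions using (DecidableEquality)
open import Relation.Nullary using (¬_; Dec; yes; no)
open import Relation.Nullary.Decidable using (from-yes; ¬?; _×-dec_; _⊎-dec_; _→-dec_)

private
  variable
    n m m′ : ℕ

-- Triples and images of subsets

∈-triple⁻ : {w a b c : Fin m} → w ∈ triple a b c → w ≡ a ⊎ w ≡ b ⊎ w ≡ c
∈-triple⁻ {a = a} {b} {c} w∈ with x∈p∪q⁻ ⁅ a ⁆ (⁅ b ⁆ ∪ ⁅ c ⁆) w∈
... | inj₁ w∈a = inj₁ (x∈⁅y⁆⇒x≡y a w∈a)
... | inj₂ w∈bc with x∈p∪q⁻ ⁅ b ⁆ ⁅ c ⁆ w∈bc
...   | inj₁ w∈b = inj₂ (inj₁ (x∈⁅y⁆⇒x≡y b w∈b))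
...   | inj₂ w∈c = inj₂ (inj₂ (x∈⁅y⁆⇒x≡y c w∈c))

∈-triple₁ : (a b c : Fin m) → a ∈ triple a b c
∈-triple₁ a b c = x∈p∪q⁺ (inj₁ (x∈⁅x⁆ a))

∈-triple₂ : (a b c : Fin m) → b ∈ triple a b c
∈-triple₂ a b c = x∈p∪q⁺ {p = ⁅ a ⁆} (inj₂ (x∈p∪q⁺ (inj₁ (x∈⁅x⁆ b))))

∈-triple₃ : (a b c : Fin m) → c ∈ triple a b c
∈-triple₃ a b c = x∈p∪q⁺ {p = ⁅ a ⁆} (inj₂ (x∈p∪q⁺ {p = ⁅ b ⁆} (inj₂ (x∈⁅x⁆ c))))

∈-triple⁺ : {w a b c : Fin m} → w ≡ a ⊎ w ≡ b ⊎ w ≡ c → w ∈ triple a b c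
∈-triple⁺ {a = a} {b} {c} (inj₁ refl)        = ∈-triple₁ a b c
∈-triple⁺ {a = a} {b} {c} (inj₂ (inj₁ refl)) = ∈-triple₂ a b c
∈-triple⁺ {a = a} {b} {c} (inj₂ (inj₂ refl)) = ∈-triple₃ a b c

∈∉⇒≢ : {x : Fin m} {p q : Subset m} → x ∈ p → x ∉ q → p ≢ q
∈∉⇒≢ x∈p x∉q refl = x∉q x∈p

∣⁅x⁆∪p∣≡1+∣p∣ : (x : Fin m) (p : Subset m) → x ∉ p → ∣ ⁅ x ⁆ ∪ p ∣ ≡ suc ∣ p ∣
∣⁅x⁆∪p∣≡1+∣p∣ zero    (inside  ∷ p) x∉p = ⊥-elim (x∉p here)
∣⁅x⁆∪p∣≡1+∣p∣ zero    (outside ∷ p) x∉p = cong (suc ∘ ∣_∣) (∪-identityˡ p)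
∣⁅x⁆∪p∣≡1+∣p∣ (suc x) (inside  ∷ p) x∉p = cong suc (∣⁅x⁆∪p∣≡1+∣p∣ x p (x∉p ∘ there))
∣⁅x⁆∪p∣≡1+∣p∣ (suc x) (outside ∷ p) x∉p = ∣⁅x⁆∪p∣≡1+∣p∣ x p (x∉p ∘ there)

∣triple∣≡3 : {a b c : Fin m} → a ≢ b → a ≢ c → b ≢ c → ∣ triple a b c ∣ ≡ 3
∣triple∣≡3 {a = a} {b} {c} a≢b a≢c b≢c = begin
  ∣ ⁅ a ⁆ ∪ ⁅ b ⁆ ∪ ⁅ c ⁆ ∣   ≡⟨ ∣⁅x⁆∪p∣≡1+∣p∣ a _ a∉bc ⟩
  suc ∣ ⁅ b ⁆ ∪ ⁅ c ⁆ ∣       ≡⟨ cong suc (∣⁅x⁆∪p∣≡1+∣p∣ b _ (b≢c ∘ x∈⁅y⁆⇒x≡y c)) ⟩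
  suc (suc ∣ ⁅ c ⁆ ∣)         ≡⟨ cong suc (cong suc (∣⁅x⁆∣≡1 c)) ⟩
  3                           ∎
  where
  open ≡-Reasoning
  a∉bc : a ∉ ⁅ b ⁆ ∪ ⁅ c ⁆
  a∉bc a∈bc with x∈p∪q⁻ ⁅ b ⁆ ⁅ c ⁆ a∈bc
  ... | inj₁ a∈b = a≢b (x∈⁅y⁆⇒x≡y b a∈b)
  ... | inj₂ a∈c = a≢c (x∈⁅y⁆⇒x≡y c a∈c)

image : (Fin m → Fin m′) → Subset m → Subset m′
image f []            = ∅
image f (outside ∷ p) = image (f ∘ suc) p
image f (inside  ∷ p) = ⁅ f zero ⁆ ∪ image (f ∘ suc) p

∈-image⁺ : (f : Fin m → Fin m′) {x : Fin m} {p : Subset m} → x ∈ p → f x ∈ image f p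
∈-image⁺ f here                             = x∈p∪q⁺ (inj₁ (x∈⁅x⁆ (f zero)))
∈-image⁺ f {p = outside ∷ _} (there x∈p) = ∈-image⁺ (f ∘ suc) x∈p
∈-image⁺ f {p = inside  ∷ _} (there x∈p) = x∈p∪q⁺ (inj₂ (∈-image⁺ (f ∘ suc) x∈p))

∈-image⁻ : (f : Fin m → Fin m′) (p : Subset m) {y : Fin m′} →
           y ∈ image f p → ∃ λ x → x ∈ p × f x ≡ y
∈-image⁻ f []            y∈ = ⊥-elim (∉⊥ y∈)
∈-image⁻ f (outside ∷ p) y∈ with ∈-image⁻ (f ∘ suc) p y∈
... | x , x∈p , fx≡y = suc x , there x∈p , fx≡y
∈-image⁻ f (inside ∷ p) y∈ with x∈p∪q⁻ ⁅ f zero ⁆ (image (f ∘ suc) p) y∈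
... | inj₁ y∈f0 = zero , here , sym (x∈⁅y⁆⇒x≡y (f zero) y∈f0)
... | inj₂ y∈fp with ∈-image⁻ (f ∘ suc) p y∈fp
...   | x , x∈p , fx≡y = suc x , there x∈p , fx≡y

module _ {f : Fin m → Fin m′} (f-injective : Injective _≡_ _≡_ f) where

  ∈-image-injective⁻ : {x : Fin m} {p : Subset m} → f x ∈ image f p → x ∈ p
  ∈-image-injective⁻ {p = p} fx∈ with ∈-image⁻ f p fx∈
  ... | _ , x′∈p , fx′≡fx = subst (_∈ p) (f-injective fx′≡fx) x′∈p

  image-injective : Injective _≡_ _≡_ (image f)
  image-injective {p} {q} fp≡fq = ⊆-antisym
    (λ x∈p → ∈-image-injective⁻ (subst (_ ∈_) fp≡fq (∈-image⁺ f x∈p)))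
    (λ x∈q → ∈-image-injective⁻ (subst (_ ∈_) (sym fp≡fq) (∈-image⁺ f x∈q)))

∣image∣≡∣p∣ : {f : Fin m → Fin m′} → Injective _≡_ _≡_ f → (p : Subset m) → ∣ image f p ∣ ≡ ∣ p ∣
∣image∣≡∣p∣ {m′ = m′} f-injective []        = ∣⊥∣≡0 m′
∣image∣≡∣p∣ f-injective (outside ∷ p)        = ∣image∣≡∣p∣ (Fin.suc-injective ∘ f-injective) p
∣image∣≡∣p∣ {f = f} f-injective (inside ∷ p) =
  trans (∣⁅x⁆∪p∣≡1+∣p∣ (f zero) _ f0∉) (cong suc (∣image∣≡∣p∣ (Fin.suc-injective ∘ f-injective) p))
  where
  f0∉ : f zero ∉ image (f ∘ suc) p
  f0∉ f0∈ with ∈-image⁻ (f ∘ suc) p f0∈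
  ... | _ , _ , f1+x≡f0 with f-injective f1+x≡f0
  ...   | ()

preimage : (Fin m → Fin m′) → Subset m′ → Subset m
preimage f q = tabulate (λ x → lookup q (f x))

module _ {f : Fin m → Fin m′} {q : Subset m′} where

  ∈-preimage⁺ : {x : Fin m} → f x ∈ q → x ∈ preimage f q
  ∈-preimage⁺ {x} fx∈q = lookup⇒[]= x _ (trans (lookup∘tabulate _ x) ([]=⇒lookup fx∈q))

  ∈-preimage⁻ : {x : Fin m} → x ∈ preimage f q → f x ∈ q
  ∈-preimage⁻ {x} x∈ = lookup⇒[]= (f x) q (trans (sym (lookup∘tabulate _ x)) ([]=⇒lookup x∈))

  image-preimage : (∀ {y} → y ∈ q → ∃ λ x → f x ≡ y) → image f (preimage f q) ≡ q
  image-preimage q⊆range = ⊆-antisym ⊆q q⊆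
    where
    ⊆q : ∀ {y} → y ∈ image f (preimage f q) → y ∈ q
    ⊆q y∈ with ∈-image⁻ f (preimage f q) y∈
    ... | _ , x∈ , refl = ∈-preimage⁻ x∈
    q⊆ : ∀ {y} → y ∈ q → y ∈ image f (preimage f q)
    q⊆ y∈q with q⊆range y∈q
    ... | _ , refl = ∈-image⁺ f (∈-preimage⁺ y∈q)

image-triple : (f : Fin m → Fin m′) (a b c : Fin m) → image f (triple a b c) ≡ triple (f a) (f b) (f c)
image-triple f a b c = ⊆-antisym ⊆fabc fabc⊆
  where
  ⊆fabc : ∀ {y} → y ∈ image f (triple a b c) → y ∈ triple (f a) (f b) (f c)
  ⊆fabc y∈ with ∈-image⁻ f _ y∈
  ... | _ , x∈ , refl = ∈-triple⁺ (Sum.map (cong f) (Sum.map (cong f) (cong f)) (∈-triple⁻ x∈))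
  fabc⊆ : ∀ {y} → y ∈ triple (f a) (f b) (f c) → y ∈ image f (triple a b c)
  fabc⊆ y∈ with ∈-triple⁻ y∈
  ... | inj₁ refl        = ∈-image⁺ f (∈-triple₁ a b c)
  ... | inj₂ (inj₁ refl) = ∈-image⁺ f (∈-triple₂ a b c)
  ... | inj₂ (inj₂ refl) = ∈-image⁺ f (∈-triple₃ a b c)

-- Berge copies of K₄

-- The edges of K₄ on Fin 4, numbered in the order e01, e02, e03, e12, e13, e23 of BergeK4.
ends : Fin 6 → Fin 4 × Fin 4
ends = lookup ((0F , 1F) ∷ (0F , 2F) ∷ (0F , 3F) ∷ (1F , 2F) ∷ (1F , 3F) ∷ (2F , 3F) ∷ [])

-- The number of the edge ij of K₄; the diagonal entries are junk.
link : Fin 4 → Fin 4 → Fin 6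
link i j = lookup (lookup table i) j
  where
  table : Vec (Vec (Fin 6) 4) 4
  table = (0F ∷ 0F ∷ 1F ∷ 2F ∷ []) ∷ (0F ∷ 0F ∷ 3F ∷ 4F ∷ []) ∷
          (1F ∷ 3F ∷ 0F ∷ 5F ∷ []) ∷ (2F ∷ 4F ∷ 5F ∷ 0F ∷ []) ∷ []

-- Proved by evaluating decision procedures; opaque, as unfolding them during type checking is very slow.
opaque
  ends-distinct : ∀ e → proj₁ (ends e) ≢ proj₂ (ends e)
  ends-distinct = from-yes (all? λ e → ¬? (proj₁ (ends e) ≟ proj₂ (ends e)))

  ends-link : ∀ i j → i ≢ j → ends (link i j) ≡ (i , j) ⊎ ends (link i j) ≡ (j , i)
  ends-link = from-yes (all? λ i → all? λ j → ¬? (i ≟ j) →-dec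
    (ends (link i j) ≟² (i , j) ⊎-dec ends (link i j) ≟² (j , i)))
    where
    _≟²_ : DecidableEquality (Fin 4 × Fin 4)
    _≟²_ = ≡-dec _≟_ _≟_

  link-injective : ∀ i j k l → i ≢ j → k ≢ l → link i j ≡ link k l → i ≡ k × j ≡ l ⊎ i ≡ l × j ≡ k
  link-injective = from-yes (all? λ i → all? λ j → all? λ k → all? λ l →
    ¬? (i ≟ j) →-dec ¬? (k ≟ l) →-dec link i j ≟ link k l →-dec
    (i ≟ k ×-dec j ≟ l ⊎-dec i ≟ l ×-dec j ≟ k))

  others : (i : Fin 4) → ∃ λ j → ∃ λ k → ∃ λ l → j ≢ i × k ≢ i × l ≢ i × j ≢ k × j ≢ l × k ≢ l
  others = from-yes (all? λ i → any? λ (j : Fin 4) → any? λ (k : Fin 4) → any? λ (l : Fin 4) →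
    ¬? (j ≟ i) ×-dec ¬? (k ≟ i) ×-dec ¬? (l ≟ i) ×-dec ¬? (j ≟ k) ×-dec ¬? (j ≟ l) ×-dec ¬? (k ≟ l))

  third : (i j : Fin 4) → ∃ λ l → l ≢ i × l ≢ j
  third = from-yes (all? λ i → all? λ j → any? λ (l : Fin 4) → ¬? (l ≟ i) ×-dec ¬? (l ≟ j))

-- The bijection φ of the definition, given as injections on the vertices and edges of K₄.
record IndexedBergeK4 (E : Hypergraph m) : Set where
  field
    vertex           : Fin 4 → Fin m
    edge             : Fin 6 → Subset m
    vertex-injective : Injective _≡_ _≡_ vertex
    edge-injective   : Injective _≡_ _≡_ edge
    edge-∈           : ∀ e → E (edge e)
    ends-∈           : ∀ e → vertex (proj₁ (ends e)) ∈ edge e × vertex (proj₂ (ends e)) ∈ edge e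

module _ {E : Hypergraph m} where

  toIndexed : BergeK4 E → IndexedBergeK4 E
  toIndexed K = record
    { vertex           = lookup vertices
    ; edge             = lookup edges
    ; vertex-injective = lookup-injective vertices-unique _ _
    ; edge-injective   = lookup-injective edges-unique _ _
    ; edge-∈           = λ { 0F → h01 ; 1F → h02 ; 2F → h03 ; 3F → h12 ; 4F → h13 ; 5F → h23 }
    ; ends-∈           = λ { 0F → m01 ; 1F → m02 ; 2F → m03 ; 3F → m12 ; 4F → m13 ; 5F → m23 }
    }
    where
    open BergeK4 K
    vertices : Vec (Fin m) 4
    vertices = x0 ∷ x1 ∷ x2 ∷ x3 ∷ []
    edges : Vec (Subset m) 6
    edges = e01 ∷ e02 ∷ e03 ∷ e12 ∷ e13 ∷ e23 ∷ []
    vertices-unique : Unique vertices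
    vertices-unique = (d01 ∷ d02 ∷ d03 ∷ []) ∷ (d12 ∷ d13 ∷ []) ∷ (d23 ∷ []) ∷ [] ∷ []
    edges-unique : Unique edges
    edges-unique = (n01-02 ∷ n01-03 ∷ n01-12 ∷ n01-13 ∷ n01-23 ∷ []) ∷
                   (n02-03 ∷ n02-12 ∷ n02-13 ∷ n02-23 ∷ []) ∷
                   (n03-12 ∷ n03-13 ∷ n03-23 ∷ []) ∷ (n12-13 ∷ n12-23 ∷ []) ∷ (n13-23 ∷ []) ∷ [] ∷ []

  fromIndexed : IndexedBergeK4 E → BergeK4 E
  fromIndexed K = record
    { x0 = vertex 0F ; x1 = vertex 1F ; x2 = vertex 2F ; x3 = vertex 3F
    ; d01 = vertex-≢ λ () ; d02 = vertex-≢ λ () ; d03 = vertex-≢ λ ()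
    ; d12 = vertex-≢ λ () ; d13 = vertex-≢ λ () ; d23 = vertex-≢ λ ()
    ; e01 = edge 0F ; e02 = edge 1F ; e03 = edge 2F ; e12 = edge 3F ; e13 = edge 4F ; e23 = edge 5F
    ; h01 = edge-∈ 0F ; h02 = edge-∈ 1F ; h03 = edge-∈ 2F
    ; h12 = edge-∈ 3F ; h13 = edge-∈ 4F ; h23 = edge-∈ 5F
    ; m01 = ends-∈ 0F ; m02 = ends-∈ 1F ; m03 = ends-∈ 2F
    ; m12 = ends-∈ 3F ; m13 = ends-∈ 4F ; m23 = ends-∈ 5F
    ; n01-02 = edge-≢ λ () ; n01-03 = edge-≢ λ () ; n01-12 = edge-≢ λ ()
    ; n01-13 = edge-≢ λ () ; n01-23 = edge-≢ λ ()
    ; n02-03 = edge-≢ λ () ; n02-12 = edge-≢ λ () ; n02-13 = edge-≢ λ () ; n02-23 = edge-≢ λ ()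
    ; n03-12 = edge-≢ λ () ; n03-13 = edge-≢ λ () ; n03-23 = edge-≢ λ ()
    ; n12-13 = edge-≢ λ () ; n12-23 = edge-≢ λ () ; n13-23 = edge-≢ λ ()
    }
    where
    open IndexedBergeK4 K
    vertex-≢ : {i j : Fin 4} → i ≢ j → vertex i ≢ vertex j
    vertex-≢ i≢j = i≢j ∘ vertex-injective
    edge-≢ : {e f : Fin 6} → e ≢ f → edge e ≢ edge f
    edge-≢ e≢f = e≢f ∘ edge-injective

EdgesAt₂ : Hypergraph m → Fin m → Subset m → Subset m → Set
EdgesAt₂ E x A B = ∀ {e} → E e → x ∈ e → e ≡ A ⊎ e ≡ B

EdgesAt₃ : Hypergraph m → Fin m → Subset m → Subset m → Subset m → Set
EdgesAt₃ E x A B C = ∀ {e} → E e → x ∈ e → e ≡ A ⊎ e ≡ B ⊎ e ≡ C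

edgesAt₃-rotate : {E : Hypergraph m} {x : Fin m} {A B C : Subset m} →
                  EdgesAt₃ E x A B C → EdgesAt₃ E x B C A
edgesAt₃-rotate at e∈E x∈e = [ inj₂ ∘ inj₂ , Sum.map₂ inj₁ ]′ (at e∈E x∈e)

edgesAt₂-≡ : {E : Hypergraph m} {x y : Fin m} {A B : Subset m} → x ≡ y → EdgesAt₂ E y A B → EdgesAt₂ E x A B
edgesAt₂-≡ refl at = at

edgesAt₃-≡ : {E : Hypergraph m} {x y : Fin m} {A B C : Subset m} →
             x ≡ y → EdgesAt₃ E y A B C → EdgesAt₃ E x A B C
edgesAt₃-≡ refl at = at

edgesAt₂-addEdge : {E : Hypergraph m} {x : Fin m} {A B S : Subset m} →
                   EdgesAt₂ E x A B → EdgesAt₃ (addEdge E S) x A B S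
edgesAt₂-addEdge at (inj₁ e∈E) x∈e = Sum.map₂ inj₁ (at e∈E x∈e)
edgesAt₂-addEdge at (inj₂ refl) _  = inj₂ (inj₂ refl)

edgesAt₂-addEdge-∉ : {E : Hypergraph m} {x : Fin m} {A B S : Subset m} →
                     x ∉ S → EdgesAt₂ E x A B → EdgesAt₂ (addEdge E S) x A B
edgesAt₂-addEdge-∉ x∉S at (inj₁ e∈E) x∈e = at e∈E x∈e
edgesAt₂-addEdge-∉ x∉S at (inj₂ refl) x∈S = ⊥-elim (x∉S x∈S)

∀⊎∃ : {P Q : Fin n → Set} → (∀ i → P i ⊎ Q i) → (∀ i → P i) ⊎ ∃ Q
∀⊎∃ {n = 0}     _   = inj₁ λ ()
∀⊎∃ {n = suc _} P⊎Q with P⊎Q zero | ∀⊎∃ (P⊎Q ∘ suc)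
... | inj₂ q | _            = inj₂ (zero , q)
... | inj₁ _ | inj₂ (i , q) = inj₂ (suc i , q)
... | inj₁ p | inj₁ ps      = inj₁ (Fin.∀-cons p ps)

pigeonhole : {A : Set} {x y z a b : A} → x ≢ y → x ≢ z → y ≢ z →
             x ≡ a ⊎ x ≡ b → y ≡ a ⊎ y ≡ b → z ≡ a ⊎ z ≡ b → ⊥
pigeonhole x≢y x≢z y≢z (inj₁ refl) (inj₁ refl) _           = x≢y refl
pigeonhole x≢y x≢z y≢z (inj₁ refl) (inj₂ refl) (inj₁ refl) = x≢z refl
pigeonhole x≢y x≢z y≢z (inj₁ refl) (inj₂ refl) (inj₂ refl) = y≢z refl
pigeonhole x≢y x≢z y≢z (inj₂ refl) (inj₁ refl) (inj₁ refl) = y≢z refl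
pigeonhole x≢y x≢z y≢z (inj₂ refl) (inj₁ refl) (inj₂ refl) = x≢z refl
pigeonhole x≢y x≢z y≢z (inj₂ refl) (inj₂ refl) _           = x≢y refl

module _ {E : Hypergraph m} (K : IndexedBergeK4 E) where
  open IndexedBergeK4 K

  vertex-∈-link : {i j : Fin 4} → i ≢ j → vertex i ∈ edge (link i j) × vertex j ∈ edge (link i j)
  vertex-∈-link {i} {j} i≢j with ends (link i j) | ends-∈ (link i j) | ends-link i j i≢j
  ... | _ | i∈ , j∈ | inj₁ refl = i∈ , j∈
  ... | _ | j∈ , i∈ | inj₂ refl = i∈ , j∈

  link-at : {i j : Fin 4} {P : Subset m → Set} → (∀ {e} → E e → vertex i ∈ e → P e) → j ≢ i →
            P (edge (link i j))
  link-at at j≢i = at (edge-∈ _) (proj₁ (vertex-∈-link (≢-sym j≢i)))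

  link-edges-distinct : {i j k : Fin 4} → j ≢ i → k ≢ i → j ≢ k → edge (link i j) ≢ edge (link i k)
  link-edges-distinct {i} {j} {k} j≢i k≢i j≢k eq
    with link-injective i j i k (≢-sym j≢i) (≢-sym k≢i) (edge-injective eq)
  ... | inj₁ (_ , j≡k) = j≢k j≡k
  ... | inj₂ (i≡k , _) = k≢i (sym i≡k)

  ¬edgesAt₂ : (i : Fin 4) {A B : Subset m} → ¬ EdgesAt₂ E (vertex i) A B
  ¬edgesAt₂ i at with others i
  ... | j , k , l , j≢i , k≢i , l≢i , j≢k , j≢l , k≢l =
    pigeonhole (link-edges-distinct j≢i k≢i j≢k) (link-edges-distinct j≢i l≢i j≢l)
               (link-edges-distinct k≢i l≢i k≢l) (link-at at j≢i) (link-at at k≢i) (link-at at l≢i)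

  edgesAt₃-link : {i : Fin 4} {A B C : Subset m} → EdgesAt₃ E (vertex i) A B C →
                  ∃ λ j → j ≢ i × edge (link i j) ≡ A
  edgesAt₃-link {i} at with others i
  ... | j , k , l , j≢i , k≢i , l≢i , j≢k , j≢l , k≢l
    with link-at at j≢i | link-at at k≢i | link-at at l≢i
  ... | inj₁ eq | _       | _       = j , j≢i , eq
  ... | inj₂ _  | inj₁ eq | _       = k , k≢i , eq
  ... | inj₂ _  | inj₂ _  | inj₁ eq = l , l≢i , eq
  ... | inj₂ j∈ | inj₂ k∈ | inj₂ l∈ =
    ⊥-elim (pigeonhole (link-edges-distinct j≢i k≢i j≢k) (link-edges-distinct j≢i l≢i j≢l)
                       (link-edges-distinct k≢i l≢i k≢l) j∈ k∈ l∈)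

  edgesAt₃-neighbour : {i : Fin 4} {A B C : Subset m} → EdgesAt₃ E (vertex i) A B C →
                       ∃ λ j → j ≢ i × vertex j ∈ A
  edgesAt₃-neighbour at with edgesAt₃-link at
  ... | j , j≢i , refl = j , j≢i , proj₂ (vertex-∈-link (≢-sym j≢i))

  edgesAt₃-cover : {i j : Fin 4} {A B C : Subset m} → EdgesAt₃ E (vertex i) A B C → j ≢ i →
                   vertex j ∈ A ⊎ vertex j ∈ B ⊎ vertex j ∈ C
  edgesAt₃-cover {i} {j} at j≢i = Sum.map into (Sum.map into into) (link-at at j≢i)
    where
    into : ∀ {X} → edge (link i j) ≡ X → vertex j ∈ X
    into eq = subst (vertex j ∈_) eq (proj₂ (vertex-∈-link (≢-sym j≢i)))

  edgesAt₃-unique : {i j : Fin 4} {A B C : Subset m} → i ≢ j →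
                    EdgesAt₃ E (vertex i) A B C → EdgesAt₃ E (vertex j) A B C → ⊥
  edgesAt₃-unique {i} {j} {A} {B} {C} i≢j at-i at-j with third i j
  ... | l , l≢i , l≢j =
    [ meets (edgesAt₃-link at-i) , [ meets (edgesAt₃-link at-i′) , meets (edgesAt₃-link at-i″) ]′ ]′
      (link-at at-j l≢j)
    where
    at-i′ : EdgesAt₃ E (vertex i) B C A
    at-i′ = edgesAt₃-rotate at-i
    at-i″ : EdgesAt₃ E (vertex i) C A B
    at-i″ = edgesAt₃-rotate at-i′
    meets : ∀ {X} → (∃ λ q → q ≢ i × edge (link i q) ≡ X) → edge (link j l) ≡ X → ⊥
    meets (q , q≢i , eq) eq′
      with link-injective i q j l (≢-sym q≢i) (≢-sym l≢j) (edge-injective (trans eq (sym eq′)))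
    ... | inj₁ (i≡j , _) = i≢j i≡j
    ... | inj₂ (i≡l , _) = l≢i (sym i≡l)

BergeK4-image : {E : Hypergraph m} {E′ : Hypergraph m′} {f : Fin m → Fin m′} → Injective _≡_ _≡_ f →
                (∀ {e} → E e → E′ (image f e)) → BergeK4 E → BergeK4 E′
BergeK4-image {f = f} f-injective f-edge K = fromIndexed (record
  { vertex           = f ∘ vertex
  ; edge             = image f ∘ edge
  ; vertex-injective = vertex-injective ∘ f-injective
  ; edge-injective   = edge-injective ∘ image-injective f-injective
  ; edge-∈           = f-edge ∘ edge-∈
  ; ends-∈           = Product.map (∈-image⁺ f) (∈-image⁺ f) ∘ ends-∈
  })
  where open IndexedBergeK4 (toIndexed K)

saturated-image : {E : Hypergraph m} {E′ : Hypergraph m′} {f : Fin m → Fin m′} → Injective _≡_ _≡_ f →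
                  (∀ {e} → E e → E′ (image f e)) → Saturated E →
                  ∀ {S} → ∣ S ∣ ≡ 3 → ¬ E′ S → (∀ {y} → y ∈ S → ∃ λ x → f x ≡ y) → BergeK4 (addEdge E′ S)
saturated-image {m = m} {E = E} {E′} {f} f-injective f-edge (_ , E-saturated) {S} ∣S∣≡3 S∉E′ S⊆range =
  subst (BergeK4 ∘ addEdge E′) image-S′≡S
        (BergeK4-image f-injective edge′ (E-saturated S′ ∣S′∣≡3 (S∉E′ ∘ subst E′ image-S′≡S ∘ f-edge)))
  where
  S′ : Subset m
  S′ = preimage f S
  image-S′≡S : image f S′ ≡ S
  image-S′≡S = image-preimage S⊆range
  ∣S′∣≡3 : ∣ S′ ∣ ≡ 3
  ∣S′∣≡3 = trans (sym (∣image∣≡∣p∣ f-injective S′)) (trans (cong ∣_∣ image-S′≡S) ∣S∣≡3)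
  edge′ : ∀ {e} → addEdge E S′ e → addEdge E′ (image f S′) (image f e)
  edge′ (inj₁ e∈E) = inj₁ (f-edge e∈E)
  edge′ (inj₂ refl) = inj₂ refl

module _ {H : Hypergraph n} {E : Hypergraph m} (f : Fin n → Fin m) (F : Subset n → Subset m)
         (F-reflects : ∀ {x T} → f x ∈ F T → x ∈ T)
         (E-traces : ∀ {e x y} → E e → x ≢ y → f x ∈ e → f y ∈ e → ∃ λ T → H T × e ≡ F T) where

  BergeK4-pullback : (K : IndexedBergeK4 E) → (∀ i → ∃ λ x → IndexedBergeK4.vertex K i ≡ f x) →
                     BergeK4 H
  BergeK4-pullback K core⊆f = fromIndexed (record
    { vertex           = vertex′
    ; edge             = proj₁ ∘ trace
    ; vertex-injective = vertex′-injective
    ; edge-injective   = λ eq → edge-injective (trans (F-trace _) (trans (cong F eq) (sym (F-trace _))))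
    ; edge-∈           = proj₁ ∘ proj₂ ∘ trace
    ; ends-∈           = λ e → Product.map (reflect e) (reflect e) (ends-∈ e)
    })
    where
    open IndexedBergeK4 K
    vertex′ : Fin 4 → Fin n
    vertex′ = proj₁ ∘ core⊆f
    f-vertex′ : ∀ i → vertex i ≡ f (vertex′ i)
    f-vertex′ = proj₂ ∘ core⊆f
    vertex′-injective : Injective _≡_ _≡_ vertex′
    vertex′-injective eq = vertex-injective (trans (f-vertex′ _) (trans (cong f eq) (sym (f-vertex′ _))))
    f-vertex′-∈ : ∀ {i e} → vertex i ∈ edge e → f (vertex′ i) ∈ edge e
    f-vertex′-∈ {i} = subst (_∈ _) (f-vertex′ i)
    trace : ∀ e → ∃ λ T → H T × edge e ≡ F T
    trace e = E-traces (edge-∈ e) (ends-distinct e ∘ vertex′-injective)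
                       (f-vertex′-∈ (proj₁ (ends-∈ e))) (f-vertex′-∈ (proj₂ (ends-∈ e)))
    F-trace : ∀ e → edge e ≡ F (proj₁ (trace e))
    F-trace = proj₂ ∘ proj₂ ∘ trace
    reflect : ∀ e {i} → vertex i ∈ edge e → vertex′ i ∈ proj₁ (trace e)
    reflect e {i} = F-reflects ∘ subst (f (vertex′ i) ∈_) (F-trace e) ∘ f-vertex′-∈

-- Attaching copies of 𝒯

module Extension {n : ℕ} (H : Hypergraph n) (k : ℕ) where

  newV : Fin k → Fin 2 → Fin (n + k * 2)
  newV c b = n ↑ʳ combine c b

  attach : Fin k → Fin n → Subset (n + k * 2)
  attach c x = triple (newV c 0F) (newV c 1F) (oldV k x)

  oldV-injective : Injective _≡_ _≡_ (oldV {n} k)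
  oldV-injective = ↑ˡ-injective (k * 2) _ _

  newV-injective : {c c′ : Fin k} {b b′ : Fin 2} → newV c b ≡ newV c′ b′ → c ≡ c′ × b ≡ b′
  newV-injective eq = combine-injective _ _ _ _ (↑ʳ-injective n _ _ eq)

  newV-≢ : ∀ c b c′ b′ → (c , b) ≢ (c′ , b′) → newV c b ≢ newV c′ b′
  newV-≢ c b c′ b′ cb≢c′b′ eq with newV-injective {c} {c′} {b} {b′} eq
  ... | refl , refl = cb≢c′b′ refl

  oldV≢newV : ∀ {x : Fin n} (c : Fin k) (b : Fin 2) → oldV k x ≢ newV c b
  oldV≢newV {x} c b eq
    with trans (sym (splitAt-↑ˡ n x (k * 2))) (trans (cong (splitAt n) eq) (splitAt-↑ʳ n (k * 2) (combine c b)))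
  ... | ()

  old-or-new : (w : Fin (n + k * 2)) → (∃ λ x → w ≡ oldV k x) ⊎ (∃₂ λ c b → w ≡ newV c b)
  old-or-new w with splitAt n w in eq
  ... | inj₁ x = inj₁ (x , sym (splitAt⁻¹-↑ˡ eq))
  ... | inj₂ z with combine-surjective {k} {2} z
  ...   | c , b , refl = inj₂ (c , b , sym (splitAt⁻¹-↑ʳ eq))

  ∈-liftSet⁺ : ∀ {T : Subset n} {x : Fin n} → x ∈ T → oldV k x ∈ liftSet k T
  ∈-liftSet⁺ {T = T} {x} x∈T = lookup⇒[]= _ _ (trans (lookup-++ˡ T _ x) ([]=⇒lookup x∈T))

  ∈-liftSet⁻ : ∀ {T : Subset n} {x : Fin n} → oldV k x ∈ liftSet k T → x ∈ T
  ∈-liftSet⁻ {T = T} {x} x∈ = lookup⇒[]= x T (trans (sym (lookup-++ˡ T _ x)) ([]=⇒lookup x∈))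

  newV∉liftSet : ∀ {T : Subset n} (c : Fin k) (b : Fin 2) → newV c b ∉ liftSet k T
  newV∉liftSet {T} c b cb∈
    with trans (sym (lookup-replicate (combine c b) outside))
               (trans (sym (lookup-++ʳ T (replicate (k * 2) outside) (combine c b))) ([]=⇒lookup cb∈))
  ... | ()

  newV-∈-attach : ∀ {c : Fin k} {x : Fin n} b → newV c b ∈ attach c x
  newV-∈-attach 0F = ∈-triple₁ _ _ _
  newV-∈-attach 1F = ∈-triple₂ _ _ _

  oldV-∈-attach : ∀ {c : Fin k} {x : Fin n} → oldV k x ∈ attach c x
  oldV-∈-attach = ∈-triple₃ _ _ _

  ∈-attach⁻ : ∀ {c : Fin k} {x : Fin n} {w} → w ∈ attach c x → (∃ λ b → w ≡ newV c b) ⊎ w ≡ oldV k x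
  ∈-attach⁻ w∈ with ∈-triple⁻ w∈
  ... | inj₁ eq        = inj₁ (0F , eq)
  ... | inj₂ (inj₁ eq) = inj₁ (1F , eq)
  ... | inj₂ (inj₂ eq) = inj₂ eq

  oldV-∈-attach⁻ : ∀ {c : Fin k} {x y : Fin n} → oldV k y ∈ attach c x → y ≡ x
  oldV-∈-attach⁻ {c} {x} y∈ with ∈-attach⁻ {c} {x} y∈
  ... | inj₁ (b , eq) = ⊥-elim (oldV≢newV c b eq)
  ... | inj₂ eq       = oldV-injective eq

  newV-∈-attach⁻ : ∀ {c c′ : Fin k} {b : Fin 2} {x : Fin n} → newV c′ b ∈ attach c x → c′ ≡ c
  newV-∈-attach⁻ {c} {c′} {b} {x} cb∈ with ∈-attach⁻ {c} {x} cb∈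
  ... | inj₁ (_ , eq) = proj₁ (newV-injective eq)
  ... | inj₂ eq       = ⊥-elim (oldV≢newV c′ b (sym eq))

  attach-injective : ∀ {c c′ : Fin k} {x y : Fin n} → attach c x ≡ attach c′ y → c ≡ c′ × x ≡ y
  attach-injective {c} {c′} {x} {y} eq =
    newV-∈-attach⁻ {c = c′} {x = y} (subst (newV c 0F ∈_) eq (newV-∈-attach {c = c} {x} 0F)) ,
    oldV-∈-attach⁻ {c = c′} (subst (oldV k x ∈_) eq (oldV-∈-attach {c = c}))

  attach≢liftSet : ∀ {c : Fin k} {x : Fin n} {T : Subset n} → attach c x ≢ liftSet k T
  attach≢liftSet {c} {x} {T} = ∈∉⇒≢ (newV-∈-attach {c = c} {x} 0F) (newV∉liftSet {T} c 0F)

  ∣attach∣≡3 : ∀ {c : Fin k} {x : Fin n} → ∣ attach c x ∣ ≡ 3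
  ∣attach∣≡3 {c} {x} =
    ∣triple∣≡3 {a = newV c 0F} {newV c 1F} {oldV k x}
               (newV-≢ c 0F c 1F λ ()) (oldV≢newV c 0F ∘ sym) (oldV≢newV c 1F ∘ sym)

  AtMostOneOld : Subset (n + k * 2) → Set
  AtMostOneOld S = ∀ {x y} → oldV k x ∈ S → oldV k y ∈ S → x ≡ y

  attach-atMostOneOld : ∀ (c : Fin k) (z : Fin n) → AtMostOneOld (attach c z)
  attach-atMostOneOld c z x∈ y∈ = trans (oldV-∈-attach⁻ {c = c} x∈) (sym (oldV-∈-attach⁻ {c = c} y∈))

  OldPairsLifted : Hypergraph (n + k * 2) → Set
  OldPairsLifted E =
    ∀ {e x y} → E e → x ≢ y → oldV k x ∈ e → oldV k y ∈ e → ∃ λ T → H T × e ≡ liftSet k T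

  addEdge-oldPairsLifted : ∀ {E : Hypergraph (n + k * 2)} {S} →
                           OldPairsLifted E → AtMostOneOld S → OldPairsLifted (addEdge E S)
  addEdge-oldPairsLifted lifted _   (inj₁ e∈E) x≢y x∈ y∈ = lifted e∈E x≢y x∈ y∈
  addEdge-oldPairsLifted _ one-old (inj₂ refl) x≢y x∈ y∈ = ⊥-elim (x≢y (one-old x∈ y∈))

  BergeK4-pullback-old : ∀ {E : Hypergraph (n + k * 2)} → OldPairsLifted E → (K : IndexedBergeK4 E) →
                         (∀ i → ∃ λ x → IndexedBergeK4.vertex K i ≡ oldV k x) → BergeK4 H
  BergeK4-pullback-old = BergeK4-pullback (oldV k) (liftSet k) ∈-liftSet⁻

  module _ {E : Hypergraph (n + k * 2)} (K : IndexedBergeK4 E) where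
    open IndexedBergeK4 K

    oldV-core≢newV-core : ∀ {i j x c b} → vertex i ≡ oldV k x → vertex j ≡ newV c b → i ≢ j
    oldV-core≢newV-core {c = c} {b} vi≡ vj≡ refl = oldV≢newV c b (trans (sym vi≡) vj≡)

    newV-core⇒oldV-core : ∀ {i c b x B C} → vertex i ≡ newV c b →
                           (∀ b → EdgesAt₃ E (newV c b) (attach c x) B C) → ∃ λ j → vertex j ≡ oldV k x
    newV-core⇒oldV-core {i} {c} {b} vi≡ at with edgesAt₃-neighbour K (edgesAt₃-≡ vi≡ (at b))
    ... | j , j≢i , vj∈ with ∈-attach⁻ vj∈
    ...   | inj₂ vj≡        = j , vj≡
    ...   | inj₁ (b′ , vj≡) =
      ⊥-elim (edgesAt₃-unique K (≢-sym j≢i) (edgesAt₃-≡ vi≡ (at b)) (edgesAt₃-≡ vj≡ (at b′)))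

    oldV-core-pair⇒H-edge : OldPairsLifted E → ∀ {i j x y} → vertex i ≡ oldV k x → vertex j ≡ oldV k y → x ≢ y →
                          ∃ λ T → H T × x ∈ T × y ∈ T
    oldV-core-pair⇒H-edge lifted {i} {j} {x} {y} vi≡ vj≡ x≢y = conclude (lifted (edge-∈ (link i j)) x≢y x∈ y∈)
      where
      i≢j : i ≢ j
      i≢j refl = x≢y (oldV-injective (trans (sym vi≡) vj≡))
      x∈ : oldV k x ∈ edge (link i j)
      x∈ = subst (_∈ edge (link i j)) vi≡ (proj₁ (vertex-∈-link K i≢j))
      y∈ : oldV k y ∈ edge (link i j)
      y∈ = subst (_∈ edge (link i j)) vj≡ (proj₂ (vertex-∈-link K i≢j))
      conclude : (∃ λ T → H T × edge (link i j) ≡ liftSet k T) → ∃ λ T → H T × x ∈ T × y ∈ T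
      conclude (T , T∈H , e≡T) =
        T , T∈H , ∈-liftSet⁻ (subst (oldV k x ∈_) e≡T x∈) , ∈-liftSet⁻ (subst (oldV k y ∈_) e≡T y∈)

  module _ (p : Fin k → Fin n × Fin n) where

    attachˡ-∈ : ∀ {c x y} → p c ≡ (x , y) → addCopies H k p (attach c x)
    attachˡ-∈ pc≡xy = inj₂ (_ , _ , _ , pc≡xy , inj₁ refl)

    attachʳ-∈ : ∀ {c x y} → p c ≡ (x , y) → addCopies H k p (attach c y)
    attachʳ-∈ pc≡xy = inj₂ (_ , _ , _ , pc≡xy , inj₂ refl)

    liftSet-∈ : ∀ {T} → H T → addCopies H k p (liftSet k T)
    liftSet-∈ T∈H = inj₁ (_ , T∈H , refl)

    attach-∈⁻ : ∀ {c x} → addCopies H k p (attach c x) → x ≡ proj₁ (p c) ⊎ x ≡ proj₂ (p c)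
    attach-∈⁻ (inj₁ (_ , _ , eq)) = ⊥-elim (attach≢liftSet eq)
    attach-∈⁻ {c} {x} (inj₂ (c′ , y , _ , pc′≡yz , inj₁ eq)) with attach-injective {c = c} {c′} {x} {y} eq
    ... | refl , refl rewrite pc′≡yz = inj₁ refl
    attach-∈⁻ {c} {x} (inj₂ (c′ , _ , z , pc′≡yz , inj₂ eq)) with attach-injective {c = c} {c′} {x} {z} eq
    ... | refl , refl rewrite pc′≡yz = inj₂ refl

    newV-edgesAt : ∀ c b →
                   EdgesAt₂ (addCopies H k p) (newV c b) (attach c (proj₁ (p c))) (attach c (proj₂ (p c)))
    newV-edgesAt c b (inj₁ (_ , _ , refl)) cb∈ = ⊥-elim (newV∉liftSet c b cb∈)
    newV-edgesAt c b (inj₂ (c′ , _ , _ , pc′≡yz , inj₁ refl)) cb∈ with newV-∈-attach⁻ {c = c′} cb∈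
    ... | refl rewrite pc′≡yz = inj₁ refl
    newV-edgesAt c b (inj₂ (c′ , _ , _ , pc′≡yz , inj₂ refl)) cb∈ with newV-∈-attach⁻ {c = c′} cb∈
    ... | refl rewrite pc′≡yz = inj₂ refl

    addCopies-oldPairsLifted : OldPairsLifted (addCopies H k p)
    addCopies-oldPairsLifted (inj₁ T∈H) _ _ _ = T∈H
    addCopies-oldPairsLifted (inj₂ (c , y , _ , _ , inj₁ refl)) x≢x′ x∈ x′∈ =
      ⊥-elim (x≢x′ (attach-atMostOneOld c y x∈ x′∈))
    addCopies-oldPairsLifted (inj₂ (c , _ , z , _ , inj₂ refl)) x≢x′ x∈ x′∈ =
      ⊥-elim (x≢x′ (attach-atMostOneOld c z x∈ x′∈))

    addCopies-free : BergeK4Free H → BergeK4Free (addCopies H k p)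
    addCopies-free H-free K = H-free (BergeK4-pullback-old addCopies-oldPairsLifted K′ old-core)
      where
      K′ : IndexedBergeK4 (addCopies H k p)
      K′ = toIndexed K
      open IndexedBergeK4 K′
      old-core : ∀ i → ∃ λ x → vertex i ≡ oldV k x
      old-core i with old-or-new (vertex i)
      ... | inj₁ old = old
      ... | inj₂ (c , b , eq) =
        ⊥-elim (¬edgesAt₂ K′ i (edgesAt₂-≡ eq (newV-edgesAt c b)))

    two-copies-BergeK4 : ∀ {u v T S c c′ b b′} → u ≢ v → H T → u ∈ T → v ∈ T →
                         p c ≡ (u , v) → p c′ ≡ (u , v) → c ≢ c′ → ¬ addCopies H k p S →
                         newV c b ∈ S → newV c′ b′ ∈ S → BergeK4 (addEdge (addCopies H k p) S)
    two-copies-BergeK4 {u} {v} {T} {S} {c} {c′} {b} {b′} u≢v T∈H u∈T v∈T pc pc′ c≢c′ S∉G cb∈S c′b′∈S = record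
      { x0 = newV c b ; x1 = newV c′ b′ ; x2 = oldV k u ; x3 = oldV k v
      ; d01 = c≢c′ ∘ proj₁ ∘ newV-injective
      ; d02 = oldV≢newV c b ∘ sym ; d03 = oldV≢newV c b ∘ sym
      ; d12 = oldV≢newV c′ b′ ∘ sym ; d13 = oldV≢newV c′ b′ ∘ sym
      ; d23 = u≢v ∘ oldV-injective
      ; e01 = S ; e02 = attach c u ; e03 = attach c v
      ; e12 = attach c′ u ; e13 = attach c′ v ; e23 = liftSet k T
      ; h01 = inj₂ refl
      ; h02 = inj₁ (attachˡ-∈ pc) ; h03 = inj₁ (attachʳ-∈ pc)
      ; h12 = inj₁ (attachˡ-∈ pc′) ; h13 = inj₁ (attachʳ-∈ pc′)
      ; h23 = inj₁ (liftSet-∈ T∈H)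
      ; m01 = cb∈S , c′b′∈S
      ; m02 = newV-∈-attach b , oldV-∈-attach ; m03 = newV-∈-attach b , oldV-∈-attach
      ; m12 = newV-∈-attach b′ , oldV-∈-attach ; m13 = newV-∈-attach b′ , oldV-∈-attach
      ; m23 = ∈-liftSet⁺ u∈T , ∈-liftSet⁺ v∈T
      ; n01-02 = S≢ (attachˡ-∈ pc) ; n01-03 = S≢ (attachʳ-∈ pc)
      ; n01-12 = S≢ (attachˡ-∈ pc′) ; n01-13 = S≢ (attachʳ-∈ pc′) ; n01-23 = S≢ (liftSet-∈ T∈H)
      ; n02-03 = u≢v ∘ proj₂ ∘ attach-injective
      ; n02-12 = c≢c′ ∘ proj₁ ∘ attach-injective ; n02-13 = c≢c′ ∘ proj₁ ∘ attach-injective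
      ; n03-12 = c≢c′ ∘ proj₁ ∘ attach-injective ; n03-13 = c≢c′ ∘ proj₁ ∘ attach-injective
      ; n02-23 = attach≢liftSet ; n03-23 = attach≢liftSet
      ; n12-13 = u≢v ∘ proj₂ ∘ attach-injective
      ; n12-23 = attach≢liftSet ; n13-23 = attach≢liftSet
      }
      where
      S≢ : ∀ {e} → addCopies H k p e → S ≢ e
      S≢ e∈G S≡e = S∉G (subst (addCopies H k p) (sym S≡e) e∈G)

module CopyEmbedding {n : ℕ} (H : Hypergraph n) (k : ℕ) where
  open Extension H k
  module One = Extension H 1

  embedCopy : Fin k → Fin (n + 1 * 2) → Fin (n + k * 2)
  embedCopy c = [ oldV k , newV c ]′ ∘ splitAt n

  embedCopy-oldV : ∀ c x → embedCopy c (oldV 1 x) ≡ oldV k x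
  embedCopy-oldV c x = cong [ oldV k , newV c ]′ (splitAt-↑ˡ n x 2)

  embedCopy-newV : ∀ c b → embedCopy c (One.newV 0F b) ≡ newV c b
  embedCopy-newV c 0F = cong [ oldV k , newV c ]′ (splitAt-↑ʳ n 2 0F)
  embedCopy-newV c 1F = cong [ oldV k , newV c ]′ (splitAt-↑ʳ n 2 1F)

  embedCopy-injective : ∀ c → Injective _≡_ _≡_ (embedCopy c)
  embedCopy-injective c {x} {y} eq =
    trans (sym (join-splitAt n 2 x))
          (trans (cong (join n 2) (sides (splitAt n x) (splitAt n y) eq)) (join-splitAt n 2 y))
    where
    sides : ∀ s t → [ oldV k , newV c ]′ s ≡ [ oldV k , newV c ]′ t → s ≡ t
    sides (inj₁ a) (inj₁ a′) eq = cong inj₁ (oldV-injective eq)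
    sides (inj₁ a) (inj₂ b′) eq = ⊥-elim (oldV≢newV c b′ eq)
    sides (inj₂ b) (inj₁ a′) eq = ⊥-elim (oldV≢newV c b (sym eq))
    sides (inj₂ b) (inj₂ b′) eq = cong inj₂ (proj₂ (newV-injective eq))

  image-attach : ∀ c x → image (embedCopy c) (One.attach 0F x) ≡ attach c x
  image-attach c x
    rewrite image-triple (embedCopy c) (One.newV 0F 0F) (One.newV 0F 1F) (oldV 1 x)
          | embedCopy-newV c 0F | embedCopy-newV c 1F | embedCopy-oldV c x = refl

  image-liftSet : ∀ c T → image (embedCopy c) (liftSet 1 T) ≡ liftSet k T
  image-liftSet c T = ⊆-antisym ⊆liftSet liftSet⊆
    where
    ⊆liftSet : ∀ {w} → w ∈ image (embedCopy c) (liftSet 1 T) → w ∈ liftSet k T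
    ⊆liftSet w∈ with ∈-image⁻ (embedCopy c) (liftSet 1 T) w∈
    ... | x , x∈ , refl with One.old-or-new x
    ...   | inj₁ (a , refl) = subst (_∈ liftSet k T) (sym (embedCopy-oldV c a)) (∈-liftSet⁺ (One.∈-liftSet⁻ x∈))
    ...   | inj₂ (c′ , b , refl) = ⊥-elim (One.newV∉liftSet c′ b x∈)
    liftSet⊆ : ∀ {w} → w ∈ liftSet k T → w ∈ image (embedCopy c) (liftSet 1 T)
    liftSet⊆ {w} w∈ with old-or-new w
    ... | inj₁ (a , refl) =
      subst (_∈ image (embedCopy c) (liftSet 1 T)) (embedCopy-oldV c a)
            (∈-image⁺ (embedCopy c) (One.∈-liftSet⁺ (∈-liftSet⁻ w∈)))
    ... | inj₂ (c′ , b , refl) = ⊥-elim (newV∉liftSet c′ b w∈)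

  embedCopy-edge : (p : Fin k → Fin n × Fin n) (c : Fin k) {e : Subset (n + 1 * 2)} →
                   addCopies H 1 (λ _ → p c) e → addCopies H k p (image (embedCopy c) e)
  embedCopy-edge p c (inj₁ (T , T∈H , refl)) = inj₁ (T , T∈H , image-liftSet c T)
  embedCopy-edge p c (inj₂ (0F , x , y , pc≡xy , inj₁ refl)) = inj₂ (c , x , y , pc≡xy , inj₁ (image-attach c x))
  embedCopy-edge p c (inj₂ (0F , x , y , pc≡xy , inj₂ refl)) = inj₂ (c , x , y , pc≡xy , inj₂ (image-attach c y))

  InCopy : Fin k → Fin (n + k * 2) → Set
  InCopy c w = ∃ λ z → embedCopy c z ≡ w

  inCopy-or-newV : ∀ c w → InCopy c w ⊎ ∃₂ λ c′ b → c′ ≢ c × w ≡ newV c′ b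
  inCopy-or-newV c w with old-or-new w
  ... | inj₁ (x , refl) = inj₁ (oldV 1 x , embedCopy-oldV c x)
  ... | inj₂ (c′ , b , refl) with c′ ≟ c
  ...   | yes refl = inj₁ (One.newV 0F b , embedCopy-newV c b)
  ...   | no c′≢c  = inj₂ (c′ , b , c′≢c , refl)

  MeetsTwoCopies : Subset (n + k * 2) → Set
  MeetsTwoCopies S = ∃₂ λ c c′ → c ≢ c′ × ∃₂ λ b b′ → newV c b ∈ S × newV c′ b′ ∈ S

  meetsTwoCopies? : ∀ S → Dec (MeetsTwoCopies S)
  meetsTwoCopies? S =
    any? λ c → any? λ c′ → ¬? (c ≟ c′) ×-dec any? λ b → any? λ b′ → newV c b ∈? S ×-dec newV c′ b′ ∈? S

  meetsCopy? : ∀ S → Dec (∃₂ λ c b → newV c b ∈ S)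
  meetsCopy? S = any? λ c → any? λ b → newV c b ∈? S

  one-copy-or-two : Fin k → ∀ S → (∃ λ c → ∀ {w} → w ∈ S → InCopy c w) ⊎ MeetsTwoCopies S
  one-copy-or-two c₀ S with meetsTwoCopies? S | meetsCopy? S
  ... | yes two | _ = inj₂ two
  ... | no ¬two | yes (c , b , cb∈S) = inj₁ (c , λ w∈S → [ id , other w∈S ]′ (inCopy-or-newV c _))
    where
    other : ∀ {w} → w ∈ S → (∃₂ λ c′ b′ → c′ ≢ c × w ≡ newV c′ b′) → InCopy c w
    other w∈S (c′ , b′ , c′≢c , refl) = ⊥-elim (¬two (c′ , c , c′≢c , b′ , b , w∈S , cb∈S))
  ... | no _ | no ¬new = inj₁ (c₀ , λ w∈S → [ id , other w∈S ]′ (inCopy-or-newV c₀ _))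
    where
    other : ∀ {w} → w ∈ S → (∃₂ λ c′ b′ → c′ ≢ c₀ × w ≡ newV c′ b′) → InCopy c₀ w
    other w∈S (c′ , b′ , _ , refl) = ⊥-elim (¬new (c′ , b′ , w∈S))

-- Copies on one pair, and on two distinct pairs

module SamePair {n : ℕ} (H : Hypergraph n) (H-free : BergeK4Free H) {u v : Fin n} (u≢v : u ≢ v) where

  G : ∀ k → Hypergraph (n + k * 2)
  G k = addCopies H k (λ _ → (u , v))

  only-u-v⇒no-edges : Uniform3 H → (∀ w → w ≡ u ⊎ w ≡ v) → ∀ {T} → ¬ H T
  only-u-v⇒no-edges H-uniform u-or-v {T} T∈H =
    n≮n 2 (subst (_≤ 2) (H-uniform T T∈H) (≤-trans (p⊆q⇒∣p∣≤∣q∣ T⊆uv) (≤-reflexive ∣uv∣≡2)))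
    where
    T⊆uv : T ⊆ ⁅ u ⁆ ∪ ⁅ v ⁆
    T⊆uv {w} _ with u-or-v w
    ... | inj₁ refl = x∈p∪q⁺ (inj₁ (x∈⁅x⁆ u))
    ... | inj₂ refl = x∈p∪q⁺ (inj₂ (x∈⁅x⁆ v))
    ∣uv∣≡2 : ∣ ⁅ u ⁆ ∪ ⁅ v ⁆ ∣ ≡ 2
    ∣uv∣≡2 = trans (∣⁅x⁆∪p∣≡1+∣p∣ u ⁅ v ⁆ (u≢v ∘ x∈⁅y⁆⇒x≡y v)) (cong suc (∣⁅x⁆∣≡1 v))

  module _ where
    open Extension H 1
    open IndexedBergeK4 using (vertex)

    third-vertex⇒edge : ∀ {w} → w ≢ u → w ≢ v → Saturated (G 1) → ∃ λ T → H T × u ∈ T × v ∈ T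
    third-vertex⇒edge {w} w≢u w≢v (_ , saturated) =
      edge-from (toIndexed (saturated (attach 0F w) (∣attach∣≡3 {0F} {w}) ([ w≢u , w≢v ]′ ∘ attach-∈⁻ _ {0F})))
      where
      E : Hypergraph (n + 1 * 2)
      E = addEdge (G 1) (attach 0F w)
      lifted : OldPairsLifted E
      lifted = addEdge-oldPairsLifted (addCopies-oldPairsLifted _) (attach-atMostOneOld 0F w)
      at : ∀ b → EdgesAt₃ E (newV 0F b) (attach 0F u) (attach 0F v) (attach 0F w)
      at b = edgesAt₂-addEdge (newV-edgesAt _ 0F b)
      edge-from : IndexedBergeK4 E → ∃ λ T → H T × u ∈ T × v ∈ T
      edge-from K with ∀⊎∃ (λ i → old-or-new (vertex K i))
      ... | inj₁ all-old = ⊥-elim (H-free (BergeK4-pullback-old lifted K all-old))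
      ... | inj₂ (i , 0F , b , vi≡)
        with newV-core⇒oldV-core K {c = 0F} vi≡ at | newV-core⇒oldV-core K {c = 0F} vi≡ (edgesAt₃-rotate ∘ at)
      ...   | _ , vju | _ , vjv = oldV-core-pair⇒H-edge K lifted vju vjv u≢v

    only-u-v⇒unsaturated : Uniform3 H → (∀ w → w ≡ u ⊎ w ≡ v) → ¬ Saturated (G 1)
    only-u-v⇒unsaturated H-uniform u-or-v (_ , saturated) =
      edgesAt₃-unique K {0F} {1F} (λ ()) (at (vertex K 0F)) (at (vertex K 1F))
      where
      no-edges : ∀ {T} → ¬ H T
      no-edges = only-u-v⇒no-edges H-uniform u-or-v
      S : Subset (n + 1 * 2)
      S = triple (newV 0F 0F) (oldV 1 u) (oldV 1 v)
      S≢attach : ∀ z → S ≢ attach 0F z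
      S≢attach z S≡ = u≢v (attach-atMostOneOld 0F z (subst (oldV 1 u ∈_) S≡ (∈-triple₂ _ _ _))
                                                    (subst (oldV 1 v ∈_) S≡ (∈-triple₃ _ _ _)))
      S∉G₁ : ¬ G 1 S
      S∉G₁ (inj₁ (_ , T∈H , _))           = no-edges T∈H
      S∉G₁ (inj₂ (0F , x , _ , _ , inj₁ S≡)) = S≢attach x S≡
      S∉G₁ (inj₂ (0F , _ , y , _ , inj₂ S≡)) = S≢attach y S≡
      ∣S∣≡3 : ∣ S ∣ ≡ 3
      ∣S∣≡3 = ∣triple∣≡3 (oldV≢newV 0F 0F ∘ sym) (oldV≢newV 0F 0F ∘ sym) (u≢v ∘ oldV-injective)
      K : IndexedBergeK4 (addEdge (G 1) S)
      K = toIndexed (saturated S ∣S∣≡3 S∉G₁)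
      at : ∀ w → EdgesAt₃ (addEdge (G 1) S) w (attach 0F u) (attach 0F v) S
      at _ (inj₁ (inj₁ (_ , T∈H , _)))                    _ = ⊥-elim (no-edges T∈H)
      at _ (inj₁ (inj₂ (0F , _ , _ , refl , inj₁ refl))) _ = inj₁ refl
      at _ (inj₁ (inj₂ (0F , _ , _ , refl , inj₂ refl))) _ = inj₂ (inj₁ refl)
      at _ (inj₂ refl)                                     _ = inj₂ (inj₂ refl)

  edge-through-u-v : Uniform3 H → Saturated (G 1) → ∃ λ T → H T × u ∈ T × v ∈ T
  edge-through-u-v H-uniform G₁-saturated with any? (λ w → ¬? (w ≟ u) ×-dec ¬? (w ≟ v))
  ... | yes (w , w≢u , w≢v) = third-vertex⇒edge w≢u w≢v G₁-saturated
  ... | no ¬third = ⊥-elim (only-u-v⇒unsaturated H-uniform u-or-v G₁-saturated)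
    where
    u-or-v : ∀ w → w ≡ u ⊎ w ≡ v
    u-or-v w with w ≟ u | w ≟ v
    ... | yes w≡u | _       = inj₁ w≡u
    ... | no _    | yes w≡v = inj₂ w≡v
    ... | no w≢u  | no w≢v  = ⊥-elim (¬third (w , w≢u , w≢v))

  addCopies-saturated : Uniform3 H → Saturated (G 1) → ∀ k → Fin k → Saturated (G k)
  addCopies-saturated H-uniform G₁-saturated k c₀ = addCopies-free _ H-free , saturate
    where
    open Extension H k
    open CopyEmbedding H k
    saturate : ∀ S → ∣ S ∣ ≡ 3 → ¬ G k S → BergeK4 (addEdge (G k) S)
    saturate S ∣S∣≡3 S∉G with one-copy-or-two c₀ S | edge-through-u-v H-uniform G₁-saturated
    ... | inj₁ (c , S⊆copy) | _ =
      saturated-image (embedCopy-injective c) (embedCopy-edge _ c) G₁-saturated ∣S∣≡3 S∉G S⊆copy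
    ... | inj₂ (c , c′ , c≢c′ , b , b′ , cb∈S , c′b′∈S) | T , T∈H , u∈T , v∈T =
      two-copies-BergeK4 _ u≢v T∈H u∈T v∈T refl refl c≢c′ S∉G cb∈S c′b′∈S

module DistinctPairs {n : ℕ} (H : Hypergraph n) (H-free : BergeK4Free H) {u v u′ v′ : Fin n} (u≢v : u ≢ v)
                     (≢uv : ¬ (u ≡ u′ × v ≡ v′)) (≢vu : ¬ (u ≡ v′ × v ≡ u′)) where
  open Extension H 2

  G₂ : Hypergraph (n + 2 * 2)
  G₂ = addCopies H 2 (twoPairs u v u′ v′)

  a₁ a₂ a₃ a₄ : Fin (n + 2 * 2)
  a₁ = newV 0F 0F
  a₂ = newV 0F 1F
  a₃ = newV 1F 0F
  a₄ = newV 1F 1F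

  S : Subset (n + 2 * 2)
  S = triple a₁ a₂ a₃

  E : Hypergraph (n + 2 * 2)
  E = addEdge G₂ S

  oldV∉S : ∀ {x} → oldV 2 x ∉ S
  oldV∉S {x} x∈S with ∈-triple⁻ x∈S
  ... | inj₁ eq        = oldV≢newV 0F 0F eq
  ... | inj₂ (inj₁ eq) = oldV≢newV 0F 1F eq
  ... | inj₂ (inj₂ eq) = oldV≢newV 1F 0F eq

  ∣S∣≡3 : ∣ S ∣ ≡ 3
  ∣S∣≡3 = ∣triple∣≡3 {a = a₁} {a₂} {a₃}
                     (newV-≢ 0F 0F 0F 1F λ ()) (newV-≢ 0F 0F 1F 0F λ ()) (newV-≢ 0F 1F 1F 0F λ ())

  S≢attach : ∀ {c x} → S ≢ attach c x
  S≢attach {c} {x} S≡ with trans (newV-∈-attach⁻ {c} {0F} {0F} {x} (subst (a₁ ∈_) S≡ (∈-triple₁ _ _ _)))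
                                 (sym (newV-∈-attach⁻ {c} {1F} {0F} {x} (subst (a₃ ∈_) S≡ (∈-triple₃ _ _ _))))
  ... | ()

  S∉G₂ : ¬ G₂ S
  S∉G₂ (inj₁ (_ , _ , S≡))             = newV∉liftSet 0F 0F (subst (a₁ ∈_) S≡ (∈-triple₁ _ _ _))
  S∉G₂ (inj₂ (c , x , _ , _ , inj₁ S≡)) = S≢attach {c} {x} S≡
  S∉G₂ (inj₂ (c , _ , y , _ , inj₂ S≡)) = S≢attach {c} {y} S≡

  at-copy₀ : ∀ b → EdgesAt₃ E (newV 0F b) (attach 0F u) (attach 0F v) S
  at-copy₀ b = edgesAt₂-addEdge (newV-edgesAt _ 0F b)

  at-a₃ : EdgesAt₃ E a₃ (attach 1F u′) (attach 1F v′) S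
  at-a₃ = edgesAt₂-addEdge (newV-edgesAt _ 1F 0F)

  at-a₄ : EdgesAt₂ E a₄ (attach 1F u′) (attach 1F v′)
  at-a₄ = edgesAt₂-addEdge-∉ a₄∉S (newV-edgesAt _ 1F 1F)
    where
    a₄∉S : a₄ ∉ S
    a₄∉S a₄∈S with ∈-triple⁻ a₄∈S
    ... | inj₁ eq        = newV-≢ 1F 1F 0F 0F (λ ()) eq
    ... | inj₂ (inj₁ eq) = newV-≢ 1F 1F 0F 1F (λ ()) eq
    ... | inj₂ (inj₂ eq) = newV-≢ 1F 1F 1F 0F (λ ()) eq

  pairs-differ : u ≡ u′ ⊎ u ≡ v′ → v ≡ u′ ⊎ v ≡ v′ → ⊥
  pairs-differ (inj₁ refl) (inj₁ refl) = u≢v refl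
  pairs-differ (inj₁ u≡u′) (inj₂ v≡v′) = ≢uv (u≡u′ , v≡v′)
  pairs-differ (inj₂ u≡v′) (inj₁ v≡u′) = ≢vu (u≡v′ , v≡u′)
  pairs-differ (inj₂ refl) (inj₂ refl) = u≢v refl

  module _ (K : IndexedBergeK4 E) where
    open IndexedBergeK4 K

    a₃-core⇒old-core⊆u′v′ : ∀ {i} → vertex i ≡ a₃ → ∀ {l x} → vertex l ≡ oldV 2 x → x ≡ u′ ⊎ x ≡ v′
    a₃-core⇒old-core⊆u′v′ vi≡a₃ vl≡
      with edgesAt₃-cover K (edgesAt₃-≡ vi≡a₃ at-a₃) (oldV-core≢newV-core K {c = 1F} {0F} vl≡ vi≡a₃)
    ... | inj₁ vl∈        = inj₁ (oldV-∈-attach⁻ {c = 1F} (subst (_∈ _) vl≡ vl∈))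
    ... | inj₂ (inj₁ vl∈) = inj₂ (oldV-∈-attach⁻ {c = 1F} (subst (_∈ _) vl≡ vl∈))
    ... | inj₂ (inj₂ vl∈) = ⊥-elim (oldV∉S (subst (_∈ S) vl≡ vl∈))

    ¬a₃-copy₀-core : ∀ {i j b} → vertex i ≡ a₃ → vertex j ≡ newV 0F b → ⊥
    ¬a₃-copy₀-core vi≡a₃ vj≡
      with newV-core⇒oldV-core K {c = 0F} vj≡ at-copy₀
         | newV-core⇒oldV-core K {c = 0F} vj≡ (edgesAt₃-rotate ∘ at-copy₀)
    ... | _ , vju | _ , vjv =
      pairs-differ (a₃-core⇒old-core⊆u′v′ vi≡a₃ vju) (a₃-core⇒old-core⊆u′v′ vi≡a₃ vjv)

    neighbour-in-S : ∀ {i w A B} → vertex i ≡ w → EdgesAt₃ E w A B S → ∃ λ j → j ≢ i × vertex j ∈ S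
    neighbour-in-S vi≡w at = edgesAt₃-neighbour K (edgesAt₃-rotate (edgesAt₃-rotate (edgesAt₃-≡ vi≡w at)))

    a₃∉core : ∀ i → vertex i ≢ a₃
    a₃∉core i vi≡a₃ with neighbour-in-S vi≡a₃ at-a₃
    ... | j , j≢i , vj∈S with ∈-triple⁻ vj∈S
    ...   | inj₁ vj≡a₁        = ¬a₃-copy₀-core vi≡a₃ vj≡a₁
    ...   | inj₂ (inj₁ vj≡a₂) = ¬a₃-copy₀-core vi≡a₃ vj≡a₂
    ...   | inj₂ (inj₂ vj≡a₃) = j≢i (vertex-injective (trans vj≡a₃ (sym vi≡a₃)))

    ¬two-copy₀-cores : ∀ {i j b b′} → i ≢ j → vertex i ≡ newV 0F b → vertex j ≡ newV 0F b′ → ⊥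
    ¬two-copy₀-cores {b = b} {b′} i≢j vi≡ vj≡ =
      edgesAt₃-unique K i≢j (edgesAt₃-≡ vi≡ (at-copy₀ b)) (edgesAt₃-≡ vj≡ (at-copy₀ b′))

    copy₀∉core : ∀ i b → vertex i ≢ newV 0F b
    copy₀∉core i b vi≡ with neighbour-in-S vi≡ (at-copy₀ b)
    ... | j , j≢i , vj∈S with ∈-triple⁻ vj∈S
    ...   | inj₁ vj≡a₁        = ¬two-copy₀-cores (≢-sym j≢i) vi≡ vj≡a₁
    ...   | inj₂ (inj₁ vj≡a₂) = ¬two-copy₀-cores (≢-sym j≢i) vi≡ vj≡a₂
    ...   | inj₂ (inj₂ vj≡a₃) = a₃∉core j vj≡a₃

    core-old : ∀ i → ∃ λ x → vertex i ≡ oldV 2 x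
    core-old i with old-or-new (vertex i)
    ... | inj₁ old               = old
    ... | inj₂ (0F , b , vi≡)  = ⊥-elim (copy₀∉core i b vi≡)
    ... | inj₂ (1F , 0F , vi≡) = ⊥-elim (a₃∉core i vi≡)
    ... | inj₂ (1F , 1F , vi≡) = ⊥-elim (¬edgesAt₂ K i (edgesAt₂-≡ vi≡ at-a₄))

  unsaturated : ¬ Saturated G₂
  unsaturated (_ , saturated) = H-free (BergeK4-pullback-old lifted K (core-old K))
    where
    K : IndexedBergeK4 E
    K = toIndexed (saturated S ∣S∣≡3 S∉G₂)
    lifted : OldPairsLifted E
    lifted = addEdge-oldPairsLifted (addCopies-oldPairsLifted _) (λ x∈S → ⊥-elim (oldV∉S x∈S))

lemma2p1 : ∀ (n : ℕ) (H : Hypergraph n) → Uniform3 H → Saturated H →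
    (∀ (u v : Fin n) → u ≢ v → CanAddT H u v →
       ∀ (k : ℕ) → 1 ≤ k → Saturated (addCopies H k (λ _ → (u , v))))
    ×
    (∀ (u v u′ v′ : Fin n) → u ≢ v → u′ ≢ v′ →
       ¬ (u ≡ u′ × v ≡ v′) → ¬ (u ≡ v′ × v ≡ u′) →
       ¬ Saturated (addCopies H 2 (twoPairs u v u′ v′)))
lemma2p1 n H H-uniform (H-free , _) = same-pair , distinct-pairs
  where
  same-pair : ∀ u v → u ≢ v → CanAddT H u v → ∀ k → 1 ≤ k → Saturated (addCopies H k (λ _ → (u , v)))
  same-pair u v u≢v G₁-saturated (suc k) _ =
    SamePair.addCopies-saturated H H-free u≢v H-uniform G₁-saturated (suc k) zero
  distinct-pairs : ∀ u v u′ v′ → u ≢ v → u′ ≢ v′ → ¬ (u ≡ u′ × v ≡ v′) → ¬ (u ≡ v′ × v ≡ u′) →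
                   ¬ Saturated (addCopies H 2 (twoPairs u v u′ v′))
  distinct-pairs u v u′ v′ u≢v _ ≢uv ≢vu = DistinctPairs.unsaturated H H-free u≢v ≢uv ≢vu
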